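{- Let $C$ be a column of type $B$ or of type $D$ which can be split. Then $C$ is admissible.
   Context: Type $B$ alphabet: $\mathcal B_n=\{1\prec 2\prec\cdots\prec n\prec 0\prec\bar n\prec\cdots\prec\bar 1\}$ (total order). Type $D$ alphabet: $\mathcal D_n=\{1,\dots,n,\bar n,\dots,\bar 1\}$ with partial order $1\prec\cdots\prec n-1\prec n\prec\overline{n-1}$, $n-1\prec\bar n\prec\overline{n-1}\prec\cdots\prec\bar 1$, where $n$ and $\bar n$ are incomparable. Conventions: $\bar 0=0$, $\bar{\bar k}=k$; $x$ is unbarred if $x\preceq n$ and barred if $x\succeq \bar n$. A column of type $B$ is a one-column Young diagram filled with letters $x_1,\dots,x_l$ (top to bottom) of $\mathcal B_n$ with $x_1\preceq\cdots\preceq x_l$, where only the letter $0$ may be repeated. A column of type $D$ is a one-column diagram filled with letters $x_1,\dots,x_l$ of $\mathcal D_n$ such that $x_{i+1}\not\preceq x_i$ for all $i$. Its height is $h(C)=l$ and its reading is $\mathrm w(C)=x_1\cdots x_l$. $C$ is admissible if $h(C)\le n$ and for every pair of positions $p,q$ with $x_p=z\preceq n$ and $x_q=\bar z$ one has $|q-p|\ge h(C)-z+1$. $C$ contains the pair $(z,\bar z)$ if $z=0$ occurs in $C$, or if $z\preceq n$ and both $z,\bar z$ occur in $C$. Splitting (type $B$): let $I_C=\{z_1\succeq z_2\succeq\cdots\succeq z_s\}$ be the multiset consisting of one copy of $0$ for each occurrence of $0$ in $C$ (these are $z_1=\dots=z_r=0$) followed by the unbarred letters $z\preceq n$ such that both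 $z$ and $\bar z$ occur in $C$, in decreasing order $z_{r+1}\succ\cdots\succ z_s$. $C$ can be split if there exist unbarred letters $t_1\succ\cdots\succ t_s$ such that $t_1$ is the greatest letter of $\mathcal B_n$ with $t_1\prec z_1$, $t_1\notin C$, $\bar t_1\notin C$, and for $i=2,\dots,s$, $t_i$ is the greatest letter with $t_i\prec\min(t_{i-1},z_i)$, $t_i\notin C$, $\bar t_i\notin C$. Then $rC$ is the column obtained by replacing, for each $i$, $\bar z_i$ by $\bar t_i$ (for $z_i=0$, the corresponding occurrence of $0$ by $\bar t_i$) and reordering, and $lC$ is obtained by replacing each $z_i$ by $t_i$ and reordering. Splitting (type $D$): for a column $C$ of type $D$, let $\widehat C$ be the column of type $B$ obtained by replacing each factor $\bar n\, n$ (consecutive letters $\bar n$ then $n$) of $\mathrm w(C)$ by $00$. $C$ can be split if $\widehat C$ can be split, and then $lC=l\widehat C$, $rC=r\widehat C$. -}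

module Defs where

open import Data.Nat using (ℕ; zero; suc; _+_; _∸_; _<_; _≤_; _*_; ∣_-_∣)
import Data.Nat as ℕ
open import Data.Fin using (Fin; toℕ)
import Data.Fin as Fin
open import Data.List using (List; []; _∷_; length; lookup; replicate; filter; reverse; _++_)
open import Data.List.Relation.Unary.Linked using (Linked)
open import Data.List.Membership.Propositional using (_∈_; _∉_)
import Data.List.Membership.DecPropositional as DecMem
open import Data.Fin.Base using ()
open import Data.Product using (_×_; _,_)
open import Data.Sum using (_⊎_)
open import Data.Unit using (⊤)
open import Data.Bool using (Bool; if_then_else_; _∧_)
open import Data.Empty using (⊥)
open import Relation.Nullary using (¬_; Dec; yes; no)
open import Relation.Nullary.Decidable using (_×-dec_)
open import Relation.Binary.PropositionalEquality using (_≡_; refl; cong)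
open import Relation.Binary.Definitions using (DecidableEquality)
import Data.List as List

-- Letters are indexed by Fin n: index i stands for the letter (toℕ i + 1).

val : {n : ℕ} → Fin n → ℕ
val i = suc (toℕ i)

-- Type B alphabet  1 ≺ 2 ≺ ⋯ ≺ n ≺ 0 ≺ n̄ ≺ ⋯ ≺ 1̄

data BLetter (n : ℕ) : Set where
  unb : Fin n → BLetter n
  zer : BLetter n
  bar : Fin n → BLetter n

rankB : {n : ℕ} → BLetter n → ℕ
rankB     (unb i) = toℕ i
rankB {n} zer     = n
rankB {n} (bar i) = (n + n) ∸ toℕ i

_≺B_ : {n : ℕ} → BLetter n → BLetter n → Set
x ≺B y = rankB x < rankB y

_⪯B_ : {n : ℕ} → BLetter n → BLetter n → Set
x ⪯B y = rankB x ≤ rankB y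

barB : {n : ℕ} → BLetter n → BLetter n
barB (unb i) = bar i
barB zer     = zer
barB (bar i) = unb i

minB : {n : ℕ} → BLetter n → BLetter n → BLetter n
minB x y with rankB x ℕ.≤? rankB y
... | yes _ = x
... | no  _ = y

_≟B_ : {n : ℕ} → DecidableEquality (BLetter n)
unb i ≟B unb j with i Fin.≟ j
... | yes refl = yes refl
... | no ne = no λ { refl → ne refl }
unb i ≟B zer = no λ ()
unb i ≟B bar j = no λ ()
zer ≟B unb j = no λ ()
zer ≟B zer = yes refl
zer ≟B bar j = no λ ()
bar i ≟B unb j = no λ ()
bar i ≟B zer = no λ ()
bar i ≟B bar j with i Fin.≟ j
... | yes refl = yes refl
... | no ne = no λ { refl → ne refl }

_∈B?_ : {n : ℕ} (x : BLetter n) (xs : List (BLetter n)) → Dec (x ∈ xs)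
_∈B?_ = DecMem._∈?_ _≟B_

IsColumnB : {n : ℕ} → List (BLetter n) → Set
IsColumnB = Linked (λ x y → x ≺B y ⊎ (x ≡ zer × y ≡ zer))

-- The multiset I_C, listed as z₁ ⪰ z₂ ⪰ ⋯ ⪰ z_s : one 0 per occurrence of 0
-- in C, followed by the unbarred z with z, z̄ ∈ C in decreasing order.
I-C : {n : ℕ} → List (BLetter n) → List (BLetter n)
I-C {n} C =
  filter (λ x → x ≟B zer) C
  ++ List.map unb (filter (λ i → (unb i ∈B? C) ×-dec (bar i ∈B? C))
                          (reverse (List.allFin n)))

IsGreatest : {n : ℕ} → (BLetter n → Set) → BLetter n → Set
IsGreatest P t = P t × (∀ y → P y → y ⪯B t)

-- admissible candidate for t_i, where m = z₁ (i = 1) or m = min(t_{i-1}, z_i)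
Cand : {n : ℕ} → List (BLetter n) → BLetter n → BLetter n → Set
Cand C m y = y ≺B m × y ∉ C × barB y ∉ C

-- SplitSeq C prev zs ts : ts = t_i, t_{i+1}, … are the letters required by the
-- splitting rule for zs = z_i, z_{i+1}, …, where prev is t_{i-1} (nothing for i = 1).
data Opt (A : Set) : Set where
  none : Opt A
  some : A → Opt A

bound : {n : ℕ} → Opt (BLetter n) → BLetter n → BLetter n
bound none     z = z
bound (some t) z = minB t z

SplitSeq : {n : ℕ} → List (BLetter n) → Opt (BLetter n)
         → List (BLetter n) → List (Fin n) → Set
SplitSeq C prev []       []       = ⊤
SplitSeq C prev []       (_ ∷ _)  = ⊥
SplitSeq C prev (_ ∷ _)  []       = ⊥
SplitSeq C prev (z ∷ zs) (t ∷ ts) =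
  IsGreatest (Cand C (bound prev z)) (unb t) × SplitSeq C (some (unb t)) zs ts

-- C can be split: there exist unbarred letters t₁ ≻ ⋯ ≻ t_s as in the rule
-- (the strict decrease is automatic from t_i ≺ t_{i-1}).
CanSplitB : {n : ℕ} → List (BLetter n) → Set
CanSplitB {n} C = Data.Product.Σ (List (Fin n)) (λ ts → SplitSeq C none (I-C C) ts)

AdmissibleB : {n : ℕ} → List (BLetter n) → Set
AdmissibleB {n} C =
  length C ≤ n ×
  (∀ (p q : Fin (length C)) (i : Fin n) →
     lookup C p ≡ unb i → lookup C q ≡ bar i →
     suc (length C) ∸ val i ≤ ∣ toℕ q - toℕ p ∣)

data DLetter (n : ℕ) : Set where
  unb : Fin n → DLetter n
  bar : Fin n → DLetter n

-- level: n and n̄ share level n, all other letters have distinct levels;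
-- x ≺ y iff level x < level y gives exactly the partial order of D_n.
levelD : {n : ℕ} → DLetter n → ℕ
levelD     (unb i) = suc (toℕ i)
levelD {n} (bar i) = (n + n) ∸ suc (toℕ i)

_≺D_ : {n : ℕ} → DLetter n → DLetter n → Set
x ≺D y = levelD x < levelD y

_⪯D_ : {n : ℕ} → DLetter n → DLetter n → Set
x ⪯D y = x ≡ y ⊎ x ≺D y

IsColumnD : {n : ℕ} → List (DLetter n) → Set
IsColumnD = Linked (λ x y → ¬ (y ⪯D x))

embD : {n : ℕ} → DLetter n → BLetter n
embD (unb i) = unb i
embD (bar i) = bar i

-- Ĉ : replace each factor  n̄ n  by  0 0
isTop : {n : ℕ} → Fin n → Bool
isTop {n} i = val i ℕ.≡ᵇ n

hat : {n : ℕ} → List (DLetter n) → List (BLetter n)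
hat [] = []
hat (x ∷ []) = embD x ∷ []
hat (unb i ∷ rest@(_ ∷ _)) = unb i ∷ hat rest
hat (bar i ∷ rest@(bar j ∷ xs)) = bar i ∷ hat rest
hat (bar i ∷ rest@(unb j ∷ xs)) =
  if isTop i ∧ isTop j then zer ∷ zer ∷ hat xs else bar i ∷ hat rest

CanSplitD : {n : ℕ} → List (DLetter n) → Set
CanSplitD C = CanSplitB (hat C)

AdmissibleD : {n : ℕ} → List (DLetter n) → Set
AdmissibleD {n} C =
  length C ≤ n ×
  (∀ (p q : Fin (length C)) (i : Fin n) →
     lookup C p ≡ unb i → lookup C q ≡ bar i →
     suc (length C) ∸ val i ≤ ∣ toℕ q - toℕ p ∣)

{-# OPTIONS --safe #-}
-- Let z, z̄ sit at positions p < q of a type B column C, and write |x| for the absolute value of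
-- a nonzero letter. Letters above z are unbarred and smaller than z, letters below z̄ are barred
-- with |x| < z, so h(C) + 1 ≤ (q − p) + #{x ∈ C : 0 < |x| ≤ z}. It therefore suffices that a
-- splittable column has at most m nonzero letters with |x| ≤ m, for every m. The letters t_i ≤ m
-- are distinct and absent from C together with their bars, and since t_i ≺ z_i there are at least
-- as many of them as entries z_i ≤ m of I_C. Sending a letter x of C to |x| if its partner is
-- absent and to a slot reserved for its pair otherwise, and t_i to t_i, is injective into
-- {1, …, m} plus one slot per such entry; this gives the bound. For m = n every 0 of C also owns
-- a t_i, which yields h(C) ≤ n. For type D, Ĉ is a column of type B of the same height that
-- agrees with C except at letters n and n̄, and a pair (n, n̄) only needs q ≠ p.
module Submission where

open import Defs
open import Data.Nat using (ℕ; suc; _+_; _∸_; _<_; _≤_; _<?_; _≤?_; _≟_; z≤n; s≤s; s≤s⁻¹; ∣_-_∣)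
open import Data.Nat.Properties
open import Data.Fin as Fin using (Fin; toℕ)
open import Data.Fin.Properties using (toℕ<n; toℕ-injective; toℕ-cast)
open import Data.List using (List; []; _∷_; length; lookup; filter; map; _++_; upTo; reverse; allFin)
open import Data.List.Properties
  using ( length-removeAt′; length-map; length-++; length-upTo
        ; filter-accept; filter-all; filter-none; filter-++)
open import Data.List.Membership.Propositional using (_∈_; _∉_; _─_)
open import Data.List.Membership.Propositional.Properties
  using (∈-lookup; ∈-map⁺; ∈-map⁻; ∈-++⁺ˡ; ∈-++⁺ʳ; ∈-++⁻; ∈-filter⁺; ∈-upTo⁺; ∈-allFin)
open import Data.List.Relation.Binary.Disjoint.Propositional using (Disjoint)
open import Data.List.Relation.Binary.Subset.Propositional using (_⊆_)
open import Data.List.Relation.Unary.Any using (here; there; index)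
open import Data.List.Relation.Unary.Any.Properties using (reverse⁺)
import Data.List.Relation.Unary.All.Properties as All
import Data.List.Relation.Unary.AllPairs.Properties as AllPairs
import Data.List.Relation.Unary.Unique.Propositional.Properties as Unique
open import Data.List.Relation.Unary.All as All using (All; []; _∷_)
open import Data.List.Relation.Unary.AllPairs as AllPairs using (AllPairs; []; _∷_)
open import Data.List.Relation.Unary.Linked using (Linked; []; [-]; _∷_)
open import Data.List.Relation.Binary.Pointwise as Pointwise using (Pointwise; []; _∷_; Pointwise-length)
open import Data.List.Relation.Binary.Sublist.Heterogeneous.Properties
  using (length-mono-≤; fromPointwise; ⊆-filter-Sublist)
open import Data.List.Relation.Unary.Linked.Properties using (Linked⇒AllPairs)
open import Data.List.Relation.Unary.Unique.Propositional using (Unique)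
open import Data.Product using (_×_; _,_; proj₁; proj₂)
open import Data.Bool using (true; false; T)
open import Data.Sum using (_⊎_; inj₁; inj₂)
open import Data.Empty using (⊥; ⊥-elim)
open import Relation.Nullary using (¬_; yes; no)
open import Relation.Nullary.Decidable using (_×-dec_)
open import Relation.Unary using (Decidable)
open import Relation.Binary.PropositionalEquality
open import Relation.Binary.Definitions using (tri<; tri≈; tri>)

module _ {A : Set} where

  ∈-─ : {x y : A} {ys : List A} (x∈ys : x ∈ ys) → y ∈ ys → y ≢ x → y ∈ ys ─ x∈ys
  ∈-─ (here refl) (here refl) y≢x = ⊥-elim (y≢x refl)
  ∈-─ (here refl) (there y∈ys) _ = y∈ys
  ∈-─ (there x∈ys) (here refl) _ = here refl
  ∈-─ (there x∈ys) (there y∈ys) y≢x = there (∈-─ x∈ys y∈ys y≢x)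

  unique⇒length≤ : {xs ys : List A} → Unique xs → xs ⊆ ys → length xs ≤ length ys
  unique⇒length≤ [] _ = z≤n
  unique⇒length≤ {x ∷ xs} {ys} (x≢xs ∷ u) xs⊆ys = begin
    suc (length xs)            ≤⟨ s≤s (unique⇒length≤ u xs⊆ys─x) ⟩
    suc (length (ys ─ x∈ys))   ≡⟨ length-removeAt′ ys (index x∈ys) ⟨
    length ys                  ∎
    where
      open ≤-Reasoning
      x∈ys = xs⊆ys (here refl)
      xs⊆ys─x : xs ⊆ ys ─ x∈ys
      xs⊆ys─x y∈xs = ∈-─ x∈ys (xs⊆ys (there y∈xs)) (≢-sym (All.lookup x≢xs y∈xs))

  mapWithAll : {P : A → Set} {R S : A → A → Set} →
               (∀ {x y} → P x → P y → R x y → S x y) →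
               {xs : List A} → All P xs → AllPairs R xs → AllPairs S xs
  mapWithAll f [] [] = []
  mapWithAll f (px ∷ pxs) (rx ∷ rxs) =
    All.zipWith (λ (py , r) → f px py r) (pxs , rx) ∷ mapWithAll f pxs rxs

  length-filter-≤ : {B : Set} {R : A → B → Set} {P : A → Set} {Q : B → Set}
                    (P? : Decidable P) (Q? : Decidable Q) → (∀ {x y} → R x y → P x → Q y) →
                    {xs : List A} {ys : List B} → Pointwise R xs ys →
                    length (filter P? xs) ≤ length (filter Q? ys)
  length-filter-≤ P? Q? P⇒Q rs = length-mono-≤ (⊆-filter-Sublist P? Q? P⇒Q (fromPointwise rs))

module _ {n : ℕ} where

  infix 4 _≺ᶜ_
  _≺ᶜ_ : BLetter n → BLetter n → Set
  x ≺ᶜ y = x ≺B y ⊎ (x ≡ zer × y ≡ zer)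

  ≺ᶜ-trans : ∀ {x y z} → x ≺ᶜ y → y ≺ᶜ z → x ≺ᶜ z
  ≺ᶜ-trans (inj₁ x≺y) (inj₁ y≺z) = inj₁ (<-trans x≺y y≺z)
  ≺ᶜ-trans (inj₁ x≺y) (inj₂ (refl , refl)) = inj₁ x≺y
  ≺ᶜ-trans (inj₂ (refl , refl)) y≺ᶜz = y≺ᶜz

  column⇒sorted : ∀ {C} → IsColumnB C → AllPairs _≺ᶜ_ C
  column⇒sorted = Linked⇒AllPairs ≺ᶜ-trans

  unb≺zer : (i : Fin n) → unb i ≺B zer
  unb≺zer = toℕ<n

  zer≺bar : (i : Fin n) → zer ≺B bar i
  zer≺bar i = begin-strict
    n               ≡⟨ m+n∸n≡m n n ⟨
    n + n ∸ n       <⟨ ∸-monoʳ-< (toℕ<n i) (m≤m+n n n) ⟩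
    n + n ∸ toℕ i   ∎
    where open ≤-Reasoning

  unb≺bar : (i j : Fin n) → unb i ≺B bar j
  unb≺bar i j = <-trans (unb≺zer i) (zer≺bar j)

  bar≺bar⇒> : {i j : Fin n} → bar i ≺B bar j → toℕ j < toℕ i
  bar≺bar⇒> = ∸-cancelʳ-<

  >⇒bar≺bar : {i j : Fin n} → toℕ j < toℕ i → bar i ≺B bar j
  >⇒bar≺bar {i} j<i = ∸-monoʳ-< j<i (≤-trans (<⇒≤ (toℕ<n i)) (m≤m+n n n))

  ≺B-irrefl : {x : BLetter n} → ¬ (x ≺B x)
  ≺B-irrefl = <-irrefl refl

  bar⊀ᶜunb : {i j : Fin n} → ¬ (bar i ≺ᶜ unb j)
  bar⊀ᶜunb {i} {j} (inj₁ p) = <-asym p (unb≺bar j i)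

  Below : ℕ → BLetter n → Set
  Below m (unb j) = toℕ j < m
  Below m zer     = ⊥
  Below m (bar j) = toℕ j < m

  below? : (m : ℕ) → Decidable (Below m)
  below? m (unb j) = toℕ j <? m
  below? m zer     = no λ ()
  below? m (bar j) = toℕ j <? m

  #below : ℕ → List (BLetter n) → ℕ
  #below m C = length (filter (below? m) C)

  #below-∷ : ∀ m x C → #below m C ≤ #below m (x ∷ C)
  #below-∷ m x C with below? m x
  ... | yes _ = n≤1+n _
  ... | no  _ = ≤-refl

  #below-∷-below : ∀ {m} x C → Below m x → #below m (x ∷ C) ≡ suc (#below m C)
  #below-∷-below {m} x C bx = cong length (filter-accept (below? m) bx)

  #below-all : ∀ {m C} → All (Below m) C → #below m C ≡ length C
  #below-all {m} all = cong length (filter-all (below? m) all)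

  ≺ᶜunb⇒below : ∀ {x} {i : Fin n} → x ≺ᶜ unb i → Below (val i) x
  ≺ᶜunb⇒below {unb j} (inj₁ j<i) = m<n⇒m<1+n j<i
  ≺ᶜunb⇒below {zer}   {i} (inj₁ p) = <-asym p (unb≺zer i)
  ≺ᶜunb⇒below {bar j} {i} (inj₁ p) = ⊥-elim (<-asym p (unb≺bar i j))

  bar≺ᶜ⇒below : ∀ {y} {i : Fin n} → bar i ≺ᶜ y → Below (val i) y
  bar≺ᶜ⇒below {unb j} p = ⊥-elim (bar⊀ᶜunb p)
  bar≺ᶜ⇒below {zer}   {i} (inj₁ p) = <-asym p (zer≺bar i)
  bar≺ᶜ⇒below {bar j} (inj₁ p) = m<n⇒m<1+n (bar≺bar⇒> p)

  length≤position+#below : ∀ {C} {i : Fin n} → AllPairs _≺ᶜ_ C →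
    (q : Fin (length C)) → lookup C q ≡ bar i → length C ≤ toℕ q + #below (val i) C
  length≤position+#below {x ∷ C} {i} (x≺C ∷ _) Fin.zero refl = begin
    suc (length C)                  ≡⟨ cong suc (#below-all (All.map bar≺ᶜ⇒below x≺C)) ⟨
    suc (#below (val i) C)          ≡⟨ #below-∷-below (bar i) C (n<1+n (toℕ i)) ⟨
    #below (val i) (bar i ∷ C)      ∎
    where open ≤-Reasoning
  length≤position+#below {x ∷ C} {i} (_ ∷ sorted) (Fin.suc q) eq =
    s≤s (≤-trans (length≤position+#below sorted q eq) (+-monoʳ-≤ (toℕ q) (#below-∷ (val i) x C)))

  length≤distance+#below : ∀ {C} {i : Fin n} → AllPairs _≺ᶜ_ C → (p q : Fin (length C)) →
        lookup C p ≡ unb i → lookup C q ≡ bar i →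
        suc (length C) ≤ toℕ q ∸ toℕ p + #below (val i) C
  length≤distance+#below {x ∷ C} (_ ∷ sorted) Fin.zero Fin.zero refl ()
  length≤distance+#below {x ∷ C} {i} (_ ∷ sorted) Fin.zero (Fin.suc q) refl lq = begin
    suc (suc (length C))                      ≤⟨ s≤s (s≤s (length≤position+#below sorted q lq)) ⟩
    suc (suc (toℕ q + #below (val i) C))       ≡⟨ cong suc (+-suc (toℕ q) _) ⟨
    suc (toℕ q) + suc (#below (val i) C)       ≡⟨ cong (suc (toℕ q) +_) unb-below ⟨
    suc (toℕ q) + #below (val i) (unb i ∷ C)   ∎
    where
      open ≤-Reasoning
      unb-below = #below-∷-below (unb i) C (n<1+n (toℕ i))
  length≤distance+#below {x ∷ C} (x≺C ∷ _) (Fin.suc p) Fin.zero lp refl =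
    ⊥-elim (bar⊀ᶜunb (subst (x ≺ᶜ_) lp (All.lookup x≺C (∈-lookup p))))
  length≤distance+#below {x ∷ C} {i} (x≺C ∷ sorted) (Fin.suc p) (Fin.suc q) lp lq = begin
    suc (suc (length C))                    ≤⟨ s≤s (length≤distance+#below sorted p q lp lq) ⟩
    suc (toℕ q ∸ toℕ p + #below (val i) C)  ≡⟨ +-suc (toℕ q ∸ toℕ p) _ ⟨
    toℕ q ∸ toℕ p + suc (#below (val i) C)  ≡⟨ cong (toℕ q ∸ toℕ p +_) (#below-∷-below x C x-below) ⟨
    toℕ q ∸ toℕ p + #below (val i) (x ∷ C)  ∎
    where
      open ≤-Reasoning
      x-below = ≺ᶜunb⇒below (subst (x ≺ᶜ_) lp (All.lookup x≺C (∈-lookup p)))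

  ≺ᶜ⇒≢ : ∀ {m x y} → Below m x → x ≺ᶜ y → x ≢ y
  ≺ᶜ⇒≢ {x = x} _ (inj₁ x≺y) refl = ≺B-irrefl {x} x≺y
  ≺ᶜ⇒≢ bx (inj₂ (refl , _)) _ = ⊥-elim bx

  n+≢ : (j k : Fin n) → n + toℕ j ≢ toℕ k
  n+≢ j k e = <⇒≢ (≤-trans (toℕ<n k) (m≤m+n n (toℕ j))) (sym e)

  zeros : List (BLetter n) → List (BLetter n)
  zeros C = filter (λ x → x ≟B zer) C

  pairIndices : List (BLetter n) → List (Fin n)
  pairIndices C = filter (λ i → (unb i ∈B? C) ×-dec (bar i ∈B? C)) (reverse (allFin n))

module _ {n : ℕ} (C : List (BLetter n)) where

  -- The injection behind the counting: a barred letter whose partner is absent takes its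
  -- partner's slot toℕ j, a paired one goes to n + toℕ j, the slot of its pair in I_C.
  code : BLetter n → ℕ
  code (unb j) = toℕ j
  code zer     = 0
  code (bar j) with unb j ∈B? C
  ... | yes _ = n + toℕ j
  ... | no  _ = toℕ j

  I-C-below : ℕ → List (BLetter n)
  I-C-below m = filter (λ z → rankB z <? m) (I-C C)

  unb∈I-C : {j : Fin n} → unb j ∈ C → bar j ∈ C → unb j ∈ I-C C
  unb∈I-C {j} uj bj =
    ∈-++⁺ʳ (zeros C) (∈-map⁺ unb (∈-filter⁺ (λ i → (unb i ∈B? C) ×-dec (bar i ∈B? C))
                                     (reverse⁺ (∈-allFin j)) (uj , bj)))

  toℕ≢code-bar : {j k : Fin n} → unb j ∈ C → toℕ j ≢ code (bar k)
  toℕ≢code-bar {j} {k} uj with unb k ∈B? C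
  ... | yes _  = λ e → n+≢ k j (sym e)
  ... | no ¬uk = λ e → ¬uk (subst (λ l → unb l ∈ C) (toℕ-injective e) uj)

  code-injective : ∀ {m x y} → x ∈ C → y ∈ C → Below m x → Below m y →
                   code x ≡ code y → x ≡ y
  code-injective {x = unb j} {unb k} _ _ _ _ e = cong unb (toℕ-injective e)
  code-injective {x = unb j} {bar k} uj _ _ _ e = ⊥-elim (toℕ≢code-bar uj e)
  code-injective {x = bar j} {unb k} _ uk _ _ e = ⊥-elim (toℕ≢code-bar uk (sym e))
  code-injective {x = bar j} {bar k} _ _ _ _ e with unb j ∈B? C | unb k ∈B? C
  ... | yes _ | yes _ = cong bar (toℕ-injective (+-cancelˡ-≡ n _ _ e))
  ... | yes _ | no  _ = ⊥-elim (n+≢ j k e)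
  ... | no  _ | yes _ = ⊥-elim (n+≢ k j (sym e))
  ... | no  _ | no  _ = cong bar (toℕ-injective e)

  code≢fresh : ∀ {m x} {t : Fin n} → x ∈ C → Below m x → unb t ∉ C → bar t ∉ C →
               code x ≢ toℕ t
  code≢fresh {x = unb j} xC _ ¬ut _ e = ¬ut (subst (λ l → unb l ∈ C) (toℕ-injective e) xC)
  code≢fresh {x = bar j} {t} xC _ _ ¬bt e with unb j ∈B? C
  ... | yes _ = n+≢ j t e
  ... | no  _ = ¬bt (subst (λ l → bar l ∈ C) (toℕ-injective e) xC)

  code∈slots : ∀ {m x} → x ∈ C → Below m x →
               code x ∈ upTo m ++ map (λ z → n + rankB z) (I-C-below m)
  code∈slots {x = unb j} _ j<m = ∈-++⁺ˡ (∈-upTo⁺ j<m)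
  code∈slots {m} {bar j} bj j<m with unb j ∈B? C
  ... | yes uj = ∈-++⁺ʳ (upTo m) (∈-map⁺ (λ z → n + rankB z)
                   (∈-filter⁺ (λ z → rankB z <? m) (unb∈I-C uj bj) j<m))
  ... | no  _  = ∈-++⁺ˡ (∈-upTo⁺ j<m)

  #below+#fresh≤slots : AllPairs _≺ᶜ_ C → (m : ℕ) (T : List (Fin n)) → Unique T →
             All (λ t → unb t ∉ C × bar t ∉ C) T → All (λ t → toℕ t < m) T →
             #below m C + length T ≤ m + length (I-C-below m)
  #below+#fresh≤slots sorted m T uniqueT fresh bounded = begin
    #below m C + length T  ≡⟨ cong₂ _+_ (length-map code L) (length-map toℕ T) ⟨
    length (map code L) + length (map toℕ T)  ≡⟨ length-++ (map code L) ⟨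
    length X               ≤⟨ unique⇒length≤ uniqueX X⊆Y ⟩
    length Y               ≡⟨ length-++ (upTo m) ⟩
    length (upTo m) + length (map (λ z → n + rankB z) (I-C-below m))
                           ≡⟨ cong₂ _+_ (length-upTo m) (length-map _ (I-C-below m)) ⟩
    m + length (I-C-below m) ∎
    where
      open ≤-Reasoning
      L = filter (below? m) C
      X = map code L ++ map toℕ T
      Y = upTo m ++ map (λ z → n + rankB z) (I-C-below m)

      L-props : All (λ x → x ∈ C × Below m x) L
      L-props = All.zip ( All.filter⁺ (below? m) (All.tabulate (λ x∈C → x∈C))
                        , All.all-filter (below? m) C)

      uniqueX : Unique X
      uniqueX = Unique.++⁺
        (AllPairs.map⁺ (mapWithAll distinct L-props (AllPairs.filter⁺ (below? m) sorted)))
        (Unique.map⁺ toℕ-injective uniqueT)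
        disjoint
        where
          distinct : ∀ {x y} → x ∈ C × Below m x → y ∈ C × Below m y → x ≺ᶜ y → code x ≢ code y
          distinct (xC , bx) (yC , by) x≺y e = ≺ᶜ⇒≢ bx x≺y (code-injective xC yC bx by e)
          disjoint : Disjoint (map code L) (map toℕ T)
          disjoint (v∈codes , v∈T) with ∈-map⁻ code v∈codes | ∈-map⁻ toℕ v∈T
          ... | x , x∈L , refl | t , t∈T , e =
            let (xC , bx) = All.lookup L-props x∈L ; (¬ut , ¬bt) = All.lookup fresh t∈T
            in code≢fresh xC bx ¬ut ¬bt e

      X⊆Y : X ⊆ Y
      X⊆Y v∈X with ∈-++⁻ (map code L) v∈X
      ... | inj₁ v∈codes with ∈-map⁻ code v∈codes
      ...   | x , x∈L , refl = let (xC , bx) = All.lookup L-props x∈L in code∈slots xC bx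
      X⊆Y v∈X | inj₂ v∈T with ∈-map⁻ toℕ v∈T
      ...   | t , t∈T , refl = ∈-++⁺ˡ (∈-upTo⁺ (All.lookup bounded t∈T))

module _ {n : ℕ} where

  minB≤ˡ : (x y : BLetter n) → rankB (minB x y) ≤ rankB x
  minB≤ˡ x y with rankB x ≤? rankB y
  ... | yes _   = ≤-refl
  ... | no  x≰y = <⇒≤ (≰⇒> x≰y)

  minB≤ʳ : (x y : BLetter n) → rankB (minB x y) ≤ rankB y
  minB≤ʳ x y with rankB x ≤? rankB y
  ... | yes x≤y = x≤y
  ... | no  _   = ≤-refl

  bound≤ : (prev : Opt (BLetter n)) (z : BLetter n) → rankB (bound prev z) ≤ rankB z
  bound≤ none     z = ≤-refl
  bound≤ (some t) z = minB≤ʳ t z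

module _ {n : ℕ} {C : List (BLetter n)} where

  SplitSeq⇒below : ∀ {prev zs ts} → SplitSeq C prev zs ts →
                   Pointwise (λ z t → toℕ t < rankB z) zs ts
  SplitSeq⇒below {zs = []} {[]} _ = []
  SplitSeq⇒below {prev} {z ∷ _} {_ ∷ _} (((t≺b , _) , _) , rest) =
    <-≤-trans t≺b (bound≤ prev z) ∷ SplitSeq⇒below rest

  SplitSeq⇒fresh : ∀ {prev zs ts} → SplitSeq C prev zs ts → All (λ t → unb t ∉ C × bar t ∉ C) ts
  SplitSeq⇒fresh {zs = []} {[]} _ = []
  SplitSeq⇒fresh {zs = _ ∷ _} {_ ∷ _} (((_ , ¬ut , ¬bt) , _) , rest) =
    (¬ut , ¬bt) ∷ SplitSeq⇒fresh rest

  SplitSeq⇒decreasing : ∀ {prev zs ts} → SplitSeq C prev zs ts → Linked (λ s t → toℕ t < toℕ s) ts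
  SplitSeq⇒decreasing {zs = []} {[]} _ = []
  SplitSeq⇒decreasing {zs = _ ∷ []} {_ ∷ []} _ = [-]
  SplitSeq⇒decreasing {zs = _ ∷ z ∷ _} {t ∷ _ ∷ _} (_ , rest@(((t′≺b , _) , _) , _)) =
    <-≤-trans t′≺b (minB≤ˡ (unb t) z) ∷ SplitSeq⇒decreasing {some (unb t)} rest

module _ {n : ℕ} where

  length≡#below+zeros : (C : List (BLetter n)) → length C ≡ #below n C + length (zeros C)
  length≡#below+zeros [] = refl
  length≡#below+zeros (unb i ∷ C) = trans (cong suc (length≡#below+zeros C))
                                           (cong (_+ _) (sym (#below-∷-below (unb i) C (toℕ<n i))))
  length≡#below+zeros (bar i ∷ C) = trans (cong suc (length≡#below+zeros C))
                                           (cong (_+ _) (sym (#below-∷-below (bar i) C (toℕ<n i))))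
  length≡#below+zeros (zer ∷ C) =
    trans (cong suc (length≡#below+zeros C)) (sym (+-suc (#below n C) _))

  I-C-below-n : (C : List (BLetter n)) → I-C-below C n ≡ map unb (pairIndices C)
  I-C-below-n C = begin
    filter R? (zeros C ++ map unb (pairIndices C))
      ≡⟨ filter-++ R? (zeros C) _ ⟩
    filter R? (zeros C) ++ filter R? (map unb (pairIndices C))
      ≡⟨ cong₂ _++_ (filter-none R? zeros-high) (filter-all R? unb-low) ⟩
    map unb (pairIndices C) ∎
    where
      open ≡-Reasoning
      R? = λ (z : BLetter n) → rankB z <? n
      zeros-high : All (λ z → ¬ rankB z < n) (zeros C)
      zeros-high = All.map (λ { refl → <-irrefl refl }) (All.all-filter (λ x → x ≟B zer) C)
      unb-low : All (λ z → rankB z < n) (map unb (pairIndices C))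
      unb-low = All.map⁺ (All.universal toℕ<n (pairIndices C))

  length-I-C : (C : List (BLetter n)) → length (I-C C) ≡ length (zeros C) + length (I-C-below C n)
  length-I-C C = trans (length-++ (zeros C))
                       (cong (λ zs → length (zeros C) + length zs) (sym (I-C-below-n C)))

module _ {n : ℕ} {C : List (BLetter n)} (column : IsColumnB C) (splitting : CanSplitB C) where

  private
    ts = proj₁ splitting
    split = proj₂ splitting

    decreasing : AllPairs (λ s t → toℕ t < toℕ s) ts
    decreasing = Linked⇒AllPairs (λ s>t t>u → <-trans t>u s>t) (SplitSeq⇒decreasing split)

    unique-ts : Unique ts
    unique-ts = AllPairs.map (λ t<s s≡t → <⇒≢ t<s (cong toℕ (sym s≡t))) decreasing

  splittable⇒#below≤ : ∀ m → #below m C ≤ m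
  splittable⇒#below≤ m = +-cancelʳ-≤ (length ts<m) _ _ (begin
    #below m C + length ts<m    ≤⟨ #below+#fresh≤slots C (column⇒sorted column) m ts<m
                                     (AllPairs.filter⁺ (λ t → toℕ t <? m) unique-ts)
                                     (All.filter⁺ (λ t → toℕ t <? m) (SplitSeq⇒fresh split))
                                     (All.all-filter (λ t → toℕ t <? m) ts) ⟩
    m + length (I-C-below C m)  ≤⟨ +-monoʳ-≤ m (length-filter-≤
                                     (λ z → rankB z <? m) (λ t → toℕ t <? m)
                                     (λ t<z z<m → <-trans t<z z<m) (SplitSeq⇒below split)) ⟩
    m + length ts<m             ∎)
    where
      open ≤-Reasoning
      ts<m = filter (λ t → toℕ t <? m) ts

  splittable⇒length≤ : length C ≤ n
  splittable⇒length≤ = +-cancelʳ-≤ F (length C) n (begin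
    length C + F                          ≡⟨ cong (_+ F) (length≡#below+zeros C) ⟩
    #below n C + length (zeros C) + F     ≡⟨ +-assoc (#below n C) _ F ⟩
    #below n C + (length (zeros C) + F)   ≡⟨ cong (#below n C +_) (length-I-C C) ⟨
    #below n C + length (I-C C)           ≡⟨ cong (#below n C +_)
                                                   (Pointwise-length (SplitSeq⇒below split)) ⟩
    #below n C + length ts                ≤⟨ #below+#fresh≤slots C (column⇒sorted column) n ts
                                               unique-ts (SplitSeq⇒fresh split)
                                               (All.universal toℕ<n ts) ⟩
    n + F                                 ∎)
    where
      open ≤-Reasoning
      F = length (I-C-below C n)

  splittable⇒admissible : AdmissibleB C
  splittable⇒admissible = splittable⇒length≤ , pair-distance
    where
      pair-distance : ∀ p q i → lookup C p ≡ unb i → lookup C q ≡ bar i →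
                      suc (length C) ∸ val i ≤ ∣ toℕ q - toℕ p ∣
      pair-distance p q i lp lq =
        ≤-trans (m≤n+o⇒m∸n≤o (suc (length C)) (val i) (begin
          suc (length C)         ≤⟨ length≤distance+#below (column⇒sorted column) p q lp lq ⟩
          d + #below (val i) C   ≤⟨ +-monoʳ-≤ d (splittable⇒#below≤ (val i)) ⟩
          d + val i              ≡⟨ +-comm d (val i) ⟩
          val i + d              ∎))
          (m∸n≤∣m-n∣ (toℕ q) (toℕ p))
        where
          open ≤-Reasoning
          d = toℕ q ∸ toℕ p

module _ {n : ℕ} where

  Top : Fin n → Set
  Top i = val i ≡ n

  isTop⇒Top : {i : Fin n} → isTop i ≡ true → Top i
  isTop⇒Top {i} e = ≡ᵇ⇒≡ (val i) n (subst T (sym e) _)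

  Top⇒isTop : {i : Fin n} → Top i → isTop i ≡ true
  Top⇒isTop {i} e with isTop i | ≡⇒≡ᵇ (val i) n e
  ... | true | _ = refl

  top-max : {j k : Fin n} → Top j → ¬ (toℕ j < toℕ k)
  top-max {j} {k} tj j<k = <⇒≱ j<k (s≤s⁻¹ (subst (val k ≤_) (sym tj) (toℕ<n k)))

  indexD : DLetter n → Fin n
  indexD (unb i) = i
  indexD (bar i) = i

  data Factor-n̄n : DLetter n → DLetter n → Set where
    n̄n : {i j : Fin n} → Top i → Top j → Factor-n̄n (bar i) (unb j)

  D-step⇒B-step : {x y : DLetter n} → ¬ (y ⪯D x) → embD x ≺B embD y ⊎ Factor-n̄n x y
  D-step⇒B-step {unb i} {unb j} y⋠x with <-cmp (toℕ i) (toℕ j)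
  ... | tri< i<j _ _ = inj₁ i<j
  ... | tri≈ _ i≡j _ = ⊥-elim (y⋠x (inj₁ (cong unb (toℕ-injective (sym i≡j)))))
  ... | tri> _ _ j<i = ⊥-elim (y⋠x (inj₂ (s≤s j<i)))
  D-step⇒B-step {unb i} {bar j} _ = inj₁ (unb≺bar i j)
  D-step⇒B-step {bar i} {bar j} y⋠x with <-cmp (toℕ j) (toℕ i)
  ... | tri< j<i _ _ = inj₁ (>⇒bar≺bar j<i)
  ... | tri≈ _ j≡i _ = ⊥-elim (y⋠x (inj₁ (cong bar (toℕ-injective j≡i))))
  ... | tri> _ _ i<j = ⊥-elim (y⋠x (inj₂ (∸-monoʳ-< (s≤s i<j) (≤-trans (toℕ<n j) (m≤m+n n n)))))
  D-step⇒B-step {bar i} {unb j} y⋠x =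
    inj₂ (n̄n (≤-antisym (toℕ<n i) (m∸n≡0⇒m≤n (n≤0⇒n≡0 slack≤0)))
             (≤-antisym (toℕ<n j) (≤-trans (m≤m+n n _) level≤val-j)))
    where
      open ≤-Reasoning
      level≤val-j : n + (n ∸ val i) ≤ val j
      level≤val-j = begin
        n + (n ∸ val i)  ≡⟨ +-∸-assoc n (toℕ<n i) ⟨
        n + n ∸ val i    ≤⟨ ≮⇒≥ (λ p → y⋠x (inj₂ p)) ⟩
        val j            ∎
      slack≤0 : n ∸ val i ≤ 0
      slack≤0 = +-cancelˡ-≤ n _ 0 (begin
        n + (n ∸ val i)  ≤⟨ ≤-trans level≤val-j (toℕ<n j) ⟩
        n                ≡⟨ +-identityʳ n ⟨
        n + 0            ∎)

  Hat : DLetter n → BLetter n → Set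
  Hat d b = b ≡ embD d ⊎ (b ≡ zer × Top (indexD d))

  hat-pointwise : (C : List (DLetter n)) → Pointwise Hat C (hat C)
  hat-pointwise [] = []
  hat-pointwise (_ ∷ []) = inj₁ refl ∷ []
  hat-pointwise (unb i ∷ rest@(_ ∷ _)) = inj₁ refl ∷ hat-pointwise rest
  hat-pointwise (bar i ∷ rest@(bar j ∷ _)) = inj₁ refl ∷ hat-pointwise rest
  hat-pointwise (bar i ∷ unb j ∷ xs)
    with hat-pointwise xs | hat-pointwise (unb j ∷ xs) | isTop i in ti | isTop j in tj
  ... | hat-xs | _       | true  | true  =
    inj₂ (refl , isTop⇒Top ti) ∷ inj₂ (refl , isTop⇒Top tj) ∷ hat-xs
  ... | _      | hat-jxs | true  | false = inj₁ refl ∷ hat-jxs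
  ... | _      | hat-jxs | false | _     = inj₁ refl ∷ hat-jxs

  ∷-column : ∀ {w y ys bs} → Pointwise Hat (y ∷ ys) bs → IsColumnB bs →
             (∀ {b} → Hat y b → w ≺ᶜ b) → IsColumnB (w ∷ bs)
  ∷-column (h ∷ _) column w≺ = w≺ h ∷ column

  hat-column : ∀ {C} → IsColumnD C → IsColumnB (hat C)
  zer-column : ∀ {j ys} → Top j → IsColumnD (unb j ∷ ys) → IsColumnB (zer ∷ hat ys)

  hat-column [] = []
  hat-column {_ ∷ []} [-] = [-]
  hat-column {unb i ∷ y ∷ ys} (y⋠x ∷ column) =
    ∷-column (hat-pointwise (y ∷ ys)) (hat-column column) unb≺
    where
      unb≺ : ∀ {b} → Hat y b → unb i ≺ᶜ b
      unb≺ (inj₁ refl) with D-step⇒B-step y⋠x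
      ... | inj₁ x≺y = inj₁ x≺y
      unb≺ (inj₂ (refl , _)) = inj₁ (unb≺zer i)
  hat-column {bar i ∷ bar j ∷ ys} (y⋠x ∷ column) =
    ∷-column (hat-pointwise (bar j ∷ ys)) (hat-column column) bar≺
    where
      bar≺bar : bar i ≺B bar j
      bar≺bar with D-step⇒B-step y⋠x
      ... | inj₁ x≺y = x≺y
      bar≺ : ∀ {b} → Hat (bar j) b → bar i ≺ᶜ b
      bar≺ (inj₁ refl) = inj₁ bar≺bar
      bar≺ (inj₂ (refl , tj)) = ⊥-elim (top-max tj (bar≺bar⇒> {i = i} {j = j} bar≺bar))
  hat-column {bar i ∷ unb j ∷ ys} (y⋠x ∷ column) with D-step⇒B-step y⋠x
  ... | inj₁ x≺y = ⊥-elim (<-asym x≺y (unb≺bar j i))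
  ... | inj₂ (n̄n ti tj) rewrite Top⇒isTop ti | Top⇒isTop tj =
    inj₂ (refl , refl) ∷ zer-column tj column

  zer-column _ [-] = [-]
  zer-column {ys = unb k ∷ ys} tj (y⋠x ∷ column) =
    ∷-column (hat-pointwise (unb k ∷ ys)) (hat-column column) zer≺
    where
      zer≺ : ∀ {b} → Hat (unb k) b → zer ≺ᶜ b
      zer≺ (inj₂ (refl , _)) = inj₂ (refl , refl)
      zer≺ (inj₁ refl) with D-step⇒B-step y⋠x
      ... | inj₁ j<k = ⊥-elim (top-max tj j<k)
  zer-column {ys = bar k ∷ ys} _ (_ ∷ column) =
    ∷-column (hat-pointwise (bar k ∷ ys)) (hat-column column) zer≺
    where
      zer≺ : ∀ {b} → Hat (bar k) b → zer ≺ᶜ b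
      zer≺ (inj₂ (refl , _)) = inj₂ (refl , refl)
      zer≺ (inj₁ refl) = inj₁ (zer≺bar k)

  Hat-nontop : ∀ {d b} → ¬ Top (indexD d) → Hat d b → b ≡ embD d
  Hat-nontop _ (inj₁ b≡d) = b≡d
  Hat-nontop ¬top (inj₂ (_ , top)) = ⊥-elim (¬top top)

module _ {n : ℕ} {C : List (DLetter n)} (column : IsColumnD C) (split : CanSplitD C) where

  private
    pointwise = hat-pointwise C
    length-hat = Pointwise-length pointwise
    hat-admissible = splittable⇒admissible (hat-column column) split

    lookup-hat : ∀ p {i} → ¬ Top i → ∀ {d} → lookup C p ≡ d → indexD d ≡ i →
                 lookup (hat C) (Fin.cast length-hat p) ≡ embD d
    lookup-hat p ¬top refl refl = Hat-nontop ¬top (Pointwise.lookup⁺ pointwise p)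

  splittableD⇒length≤ : length C ≤ n
  splittableD⇒length≤ = subst (_≤ n) (sym length-hat) (proj₁ hat-admissible)

  splittableD⇒admissible : AdmissibleD C
  splittableD⇒admissible = splittableD⇒length≤ , pair-distance
    where
      pair-distance : ∀ p q i → lookup C p ≡ unb i → lookup C q ≡ bar i →
                      suc (length C) ∸ val i ≤ ∣ toℕ q - toℕ p ∣
      pair-distance p q i lp lq with val i ≟ n
      ... | no ¬top =
        subst₂ (λ h d → suc h ∸ val i ≤ d) (sym length-hat)
               (cong₂ ∣_-_∣ (toℕ-cast length-hat q) (toℕ-cast length-hat p))
               (proj₂ hat-admissible _ _ i (lookup-hat p ¬top lp refl) (lookup-hat q ¬top lq refl))
      ... | yes top = ≤-trans at-most-1 (n≢0⇒n>0 p≢q)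
        where
          open ≤-Reasoning
          at-most-1 : suc (length C) ∸ val i ≤ 1
          at-most-1 = begin
            suc (length C) ∸ val i  ≡⟨ cong (suc (length C) ∸_) top ⟩
            suc (length C) ∸ n      ≤⟨ ∸-monoˡ-≤ n (s≤s splittableD⇒length≤) ⟩
            suc n ∸ n               ≡⟨ m+n∸n≡m 1 n ⟩
            1                       ∎
          p≢q : ∣ toℕ q - toℕ p ∣ ≢ 0
          p≢q d≡0 with trans (sym lp) (trans (cong (lookup C) p≡q) lq)
            where p≡q = toℕ-injective (sym (∣m-n∣≡0⇒m≡n d≡0))
          ... | ()

lemma3p1p8 : (n : ℕ) →
    ((C : List (BLetter n)) → IsColumnB C → CanSplitB C → AdmissibleB C) ×
    ((C : List (DLetter n)) → IsColumnD C → CanSplitD C → AdmissibleD C)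
lemma3p1p8 n = (λ _ → splittable⇒admissible) , (λ _ → splittableD⇒admissible)
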